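{- Let $G$ be a graph such that every connected component has at least $3$ vertices, and let $X_1,\ldots,X_t$ be subsets of $V(G)$ such that: (i) for any distinct $i,j\in\{1,\dots,t\}$, $\mathsf{dist}_G(X_i,X_j)\ge 3$; (ii) for each $i$, every set of non-edges of $G$ whose addition to $G$ puts every vertex of $X_i$ in a triangle has size at least $a_i$. Then every $\Delta$-completion set of $G$ has at least $\sum_{i=1}^t a_i$ edges.
   Context: All graphs are finite and simple. A $\Delta$-completion set of $G$ is a set $F$ of non-edges of $G$ such that every vertex of $G+F$ lies in a triangle. For $A,B\subseteq V(G)$, $\mathsf{dist}_G(A,B)=\min\{\mathsf{dist}_G(u,v): u\in A, v\in B\}$, where $\mathsf{dist}_G(u,v)$ is the length of a shortest $u$–$v$ path. -}

module Defs where

open import Data.Nat using (ℕ; zero; suc; _≤_; _<_; _<ᵇ_)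
open import Data.Bool using (Bool; true; false; _∨_; _∧_; if_then_else_)
open import Data.Fin using (Fin; toℕ)
open import Data.Fin.Subset using (Subset; _∈_)
open import Data.Vec using (tabulate; sum)
open import Data.Product using (Σ; ∃; _×_; _,_)
open import Relation.Binary.PropositionalEquality using (_≡_; _≢_)

record Graph (n : ℕ) : Set where
  field
    adj    : Fin n → Fin n → Bool
    sym    : ∀ u v → adj u v ≡ adj v u
    irrefl : ∀ v → adj v v ≡ false
open Graph public

data Walk {n : ℕ} (G : Graph n) : Fin n → Fin n → ℕ → Set where
  here : ∀ v → Walk G v v 0
  step : ∀ {u w v k} → adj G u w ≡ true → Walk G w v k → Walk G u v (suc k)

Connected : ∀ {n} → Graph n → Fin n → Fin n → Set
Connected G u v = ∃ λ k → Walk G u v k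

ComponentsAtLeast3 : ∀ {n} → Graph n → Set
ComponentsAtLeast3 {n} G = ∀ (v : Fin n) →
  Σ (Fin n) λ a → Σ (Fin n) λ b → Σ (Fin n) λ c →
    (a ≢ b) × (a ≢ c) × (b ≢ c) ×
    Connected G v a × Connected G v b × Connected G v c

-- dist_G(A,B) ≥ d : every walk from A to B has length ≥ d
-- (the distance of the shortest path is the minimal walk length;
--  vacuous when A and B lie in different components, distance = ∞)
DistAtLeast : ∀ {n} → Graph n → Subset n → Subset n → ℕ → Set
DistAtLeast G A B d = ∀ u v k → u ∈ A → v ∈ B → Walk G u v k → d ≤ k

record NonEdgeSet {n : ℕ} (G : Graph n) : Set where
  field
    mem     : Fin n → Fin n → Bool
    memSym  : ∀ u v → mem u v ≡ mem v u
    nonEdge : ∀ u v → mem u v ≡ true → (u ≢ v) × (adj G u v ≡ false)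
open NonEdgeSet public

size : ∀ {n} {G : Graph n} → NonEdgeSet G → ℕ
size {n} F = sum (tabulate λ (u : Fin n) → sum (tabulate λ (v : Fin n) →
  if (toℕ u <ᵇ toℕ v) ∧ mem F u v then 1 else 0))

adjPlus : ∀ {n} (G : Graph n) → NonEdgeSet G → Fin n → Fin n → Bool
adjPlus G F u v = adj G u v ∨ mem F u v

InTriangle : ∀ {n} (G : Graph n) → NonEdgeSet G → Fin n → Set
InTriangle {n} G F v = Σ (Fin n) λ a → Σ (Fin n) λ b →
  (adjPlus G F v a ≡ true) × (adjPlus G F v b ≡ true) × (adjPlus G F a b ≡ true)

Completes : ∀ {n} (G : Graph n) → NonEdgeSet G → Subset n → Set
Completes G F X = ∀ v → v ∈ X → InTriangle G F v

IsΔCompletion : ∀ {n} (G : Graph n) → NonEdgeSet G → Set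
IsΔCompletion G F = ∀ v → InTriangle G F v

{-# OPTIONS --safe #-}
-- Let ball i be the closed neighbourhood of X i.  Distance ≥ 3 makes the balls pairwise disjoint
-- and leaves no edge of G between ball i and X j for i ≢ j.  Split a Δ-completion F into the edges
-- inside a ball and the external ones.  A vertex of X i whose triangle in G + F stays in ball i is
-- already completed by the edges of F inside ball i; every other ("bad") vertex has an external
-- edge.  Fᵢ consists of the edges of F inside ball i plus one new edge per vertex of D ∩ X i,
-- closing a triangle through the vertex and a partner (components of size ≥ 3 provide one).
-- D is the set of bad vertices minus the partners of leaves: a leaf is a bad vertex whose only
-- external edge goes to another bad vertex, and its partner is the vertex of its triangle inside
-- its ball (one leaf per external neighbour suffices).  Discharging on the external edges shows
-- that |D| is at most their number, so Σ |Fᵢ| ≤ |F|, and aᵢ ≤ |Fᵢ| gives the claim.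
module Submission where

open import Defs renaming (sym to adj-sym)
open import Data.Nat using (ℕ; zero; suc; _+_; _*_; _≤_; _<_; z≤n; s≤s; _<ᵇ_) renaming (_≟_ to _≟ℕ_)
open import Data.Nat.Properties
  using (+-assoc; +-comm; +-identityʳ; +-mono-≤; +-monoʳ-≤; +-cancelʳ-≤; *-monoʳ-≤; *-cancelˡ-≤;
         ≤-refl; ≤-trans; ≤-reflexive; m≤m+n; m≤n+m; <⇒≤; <⇒≱; ≤∧≢⇒<; 1+n≰n; <-cmp; <⇒<ᵇ; <ᵇ⇒<;
         +-*-semiring; module ≤-Reasoning)
open import Data.Bool using (Bool; true; false; _∧_; _∨_; not; if_then_else_) renaming (_≟_ to _≟ᵇ_)
open import Data.Fin using (Fin; zero; suc; toℕ; _≟_)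
open import Data.Fin.Properties using (toℕ-injective; suc-injective; any?)
open import Data.Fin.Subset using (Subset)
open import Data.Vec using (tabulate; sum; lookup)
open import Data.Vec.Properties using (lookup⇒[]=; []=⇒lookup)
open import Data.Maybe using (Maybe; just; nothing; maybe)
open import Data.Maybe.Properties using (just-injective)
open import Data.Product using (∃-syntax; _×_; _,_; proj₁; proj₂)
open import Data.Sum using (_⊎_; inj₁; inj₂; reduce; [_,_]′)
open import Data.Empty using (⊥; ⊥-elim)
open import Function using (_∘_; Equivalence)
open import Data.Bool.Properties using (T-≡; ∧-zeroʳ; ∧-comm; ∨-comm; ¬-not)
open import Relation.Binary using (tri<; tri≈; tri>)
open import Relation.Nullary using (¬_; Dec; yes; no; does; _⊎-dec_)
open import Relation.Nullary.Decidable using (dec-true; dec-false)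
open import Relation.Binary.PropositionalEquality
open import Algebra.Properties.Semiring.Sum +-*-semiring
  using (∑-distrib-+; ∑-comm; sum-cong-≗; sum-replicate-zero; *-distribˡ-sum)
  renaming (sum to ∑)

Rel : ℕ → Set
Rel n = Fin n → Fin n → Bool

⟦_⟧ : Bool → ℕ
⟦ b ⟧ = if b then 1 else 0

_==_ : ∀ {n} → Fin n → Fin n → Bool
x == y = does (x ≟ y)

any : ∀ {n} → (Fin n → Bool) → Bool
any {zero}  P = false
any {suc n} P = P zero ∨ any (P ∘ suc)

count : ∀ {n} → (Fin n → Bool) → ℕ
count P = ∑ λ x → ⟦ P x ⟧

-- Edge sets are counted as ordered pairs, which avoids the u < v restriction of size
-- (pairs-mem converts back).
pairs : ∀ {n} → Rel n → ℕ
pairs R = ∑ λ u → count (R u)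

true≢false : ∀ {b} → b ≡ true → b ≡ false → ⊥
true≢false refl ()

∧-intro : ∀ {a b} → a ≡ true → b ≡ true → a ∧ b ≡ true
∧-intro refl refl = refl

∧-elim : ∀ {a b} → a ∧ b ≡ true → a ≡ true × b ≡ true
∧-elim {true} b≡true = refl , b≡true

∨-introˡ : ∀ {a} b → a ≡ true → a ∨ b ≡ true
∨-introˡ _ refl = refl

∨-introʳ : ∀ a {b} → b ≡ true → a ∨ b ≡ true
∨-introʳ true  _    = refl
∨-introʳ false refl = refl

∨-elim : ∀ {a b} → a ∨ b ≡ true → a ≡ true ⊎ b ≡ true
∨-elim {true}  _ = inj₁ refl
∨-elim {false} b≡true = inj₂ b≡true

not-intro : ∀ {b} → b ≡ false → not b ≡ true
not-intro refl = refl

not-elim : ∀ {b} → not b ≡ true → b ≡ false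
not-elim {false} _ = refl

∧-not-false : ∀ {a b} → a ≡ true → a ∧ not b ≡ false → b ≡ true
∧-not-false {b = true}  _    _  = refl
∧-not-false {b = false} refl ()

does-sound : ∀ {P : Set} (P? : Dec P) → does P? ≡ true → P
does-sound (yes p) _ = p

==-sound : ∀ {n} {x y : Fin n} → x == y ≡ true → x ≡ y
==-sound {x = x} {y} = does-sound (x ≟ y)

==-refl : ∀ {n} (x : Fin n) → x == x ≡ true
==-refl x = dec-true (x ≟ x) refl

any-intro : ∀ {n} (P : Fin n → Bool) i → P i ≡ true → any P ≡ true
any-intro P zero    Pi = ∨-introˡ _ Pi
any-intro P (suc i) Pi = ∨-introʳ (P zero) (any-intro (P ∘ suc) i Pi)

any-cong : ∀ {n} {P Q : Fin n → Bool} → (∀ i → P i ≡ Q i) → any P ≡ any Q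
any-cong {zero}  P≗Q = refl
any-cong {suc n} P≗Q = cong₂ _∨_ (P≗Q zero) (any-cong (P≗Q ∘ suc))

any-elim : ∀ {n} (P : Fin n → Bool) → any P ≡ true → ∃[ i ] P i ≡ true
any-elim {suc n} P anyP with ∨-elim {P zero} anyP
... | inj₁ P0 = zero , P0
... | inj₂ anyP′ with any-elim (P ∘ suc) anyP′
... | i , Pi = suc i , Pi

find : ∀ {n} → (Fin n → Bool) → Maybe (Fin n)
find P with any? (λ i → P i ≟ᵇ true)
... | yes (i , _) = just i
... | no _        = nothing

find-sound : ∀ {n} (P : Fin n → Bool) {i} → find P ≡ just i → P i ≡ true
find-sound P eq with any? (λ i → P i ≟ᵇ true)
find-sound P refl | yes (i , Pi) = Pi

find-complete : ∀ {n} (P : Fin n → Bool) i → P i ≡ true → ∃[ j ] find P ≡ just j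
find-complete P i Pi with any? (λ i → P i ≟ᵇ true)
... | yes (j , _) = j , refl
... | no none     = ⊥-elim (none (i , Pi))

sum-tabulate : ∀ {n} (f : Fin n → ℕ) → sum (tabulate f) ≡ ∑ f
sum-tabulate {zero}  f = refl
sum-tabulate {suc n} f = cong (f zero +_) (sum-tabulate (f ∘ suc))

∑-zero : ∀ n → ∑ {n} (λ _ → 0) ≡ 0
∑-zero = sum-replicate-zero

∑-mono : ∀ {n} {f g : Fin n → ℕ} → (∀ i → f i ≤ g i) → ∑ f ≤ ∑ g
∑-mono {zero}  f≤g = z≤n
∑-mono {suc n} f≤g = +-mono-≤ (f≤g zero) (∑-mono (f≤g ∘ suc))

∑-mono-slack : ∀ {n} {f g : Fin n → ℕ} {k} i → (∀ j → f j ≤ g j) → f i + k ≤ g i → ∑ f + k ≤ ∑ g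
∑-mono-slack {f = f} {g} {k} zero f≤g slack = begin
  f zero + ∑ (f ∘ suc) + k ≡⟨ +-assoc (f zero) _ k ⟩
  f zero + (∑ (f ∘ suc) + k) ≡⟨ cong (f zero +_) (+-comm _ k) ⟩
  f zero + (k + ∑ (f ∘ suc)) ≡⟨ +-assoc (f zero) k _ ⟨
  f zero + k + ∑ (f ∘ suc)   ≤⟨ +-mono-≤ slack (∑-mono (f≤g ∘ suc)) ⟩
  g zero + ∑ (g ∘ suc)       ∎
  where open ≤-Reasoning
∑-mono-slack {f = f} {g} {k} (suc i) f≤g slack = begin
  f zero + ∑ (f ∘ suc) + k   ≡⟨ +-assoc (f zero) _ k ⟩
  f zero + (∑ (f ∘ suc) + k) ≤⟨ +-mono-≤ (f≤g zero) (∑-mono-slack i (f≤g ∘ suc) slack) ⟩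
  g zero + ∑ (g ∘ suc)       ∎
  where open ≤-Reasoning

≤-∑ : ∀ {n} (f : Fin n → ℕ) i → f i ≤ ∑ f
≤-∑ {n} f i = subst (_≤ ∑ f) (cong (_+ f i) (∑-zero n)) (∑-mono-slack {f = λ _ → 0} i (λ _ → z≤n) ≤-refl)

+-≤-∑ : ∀ {n} (f : Fin n → ℕ) {i j} → i ≢ j → f i + f j ≤ ∑ f
+-≤-∑ f {zero}  {zero}  i≢j = ⊥-elim (i≢j refl)
+-≤-∑ f {zero}  {suc j} _   = +-monoʳ-≤ (f zero) (≤-∑ (f ∘ suc) j)
+-≤-∑ f {suc i} {zero}  _   = subst (_≤ ∑ f) (+-comm (f zero) _) (+-monoʳ-≤ (f zero) (≤-∑ (f ∘ suc) i))
+-≤-∑ f {suc i} {suc j} i≢j = ≤-trans (+-≤-∑ (f ∘ suc) (i≢j ∘ cong suc)) (m≤n+m _ (f zero))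

⟦⟧≤1 : ∀ b → ⟦ b ⟧ ≤ 1
⟦⟧≤1 true  = ≤-refl
⟦⟧≤1 false = z≤n

⟦∧⟧≤ˡ : ∀ a b → ⟦ a ∧ b ⟧ ≤ ⟦ a ⟧
⟦∧⟧≤ˡ true  b = ⟦⟧≤1 b
⟦∧⟧≤ˡ false b = z≤n

⟦∧⟧≤ʳ : ∀ a b → ⟦ a ∧ b ⟧ ≤ ⟦ b ⟧
⟦∧⟧≤ʳ true  b = ≤-refl
⟦∧⟧≤ʳ false b = z≤n

⟦∨⟧≤ : ∀ a b → ⟦ a ∨ b ⟧ ≤ ⟦ a ⟧ + ⟦ b ⟧
⟦∨⟧≤ true  b = s≤s z≤n
⟦∨⟧≤ false b = ≤-refl

⟦⟧-split : ∀ a b → ⟦ a ⟧ ≡ ⟦ a ∧ b ⟧ + ⟦ a ∧ not b ⟧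
⟦⟧-split true  true  = refl
⟦⟧-split true  false = refl
⟦⟧-split false b     = refl

count-false : ∀ {n} (P : Fin n → Bool) → (∀ i → P i ≡ false) → count P ≡ 0
count-false {n} P none = trans (sum-cong-≗ (λ i → cong ⟦_⟧ (none i))) (∑-zero n)

⟦any⟧≤count : ∀ {n} (P : Fin n → Bool) → ⟦ any P ⟧ ≤ count P
⟦any⟧≤count {zero}  P = z≤n
⟦any⟧≤count {suc n} P =
  ≤-trans (⟦∨⟧≤ (P zero) (any (P ∘ suc))) (+-monoʳ-≤ ⟦ P zero ⟧ (⟦any⟧≤count (P ∘ suc)))

count-≥1 : ∀ {n} (P : Fin n → Bool) {i} → P i ≡ true → 1 ≤ count P
count-≥1 P {i} Pi = subst (_≤ count P) (cong ⟦_⟧ Pi) (≤-∑ (λ x → ⟦ P x ⟧) i)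

count-≥2 : ∀ {n} (P : Fin n → Bool) {i j} → i ≢ j → P i ≡ true → P j ≡ true → 2 ≤ count P
count-≥2 P i≢j Pi Pj =
  subst (_≤ count P) (cong₂ (λ a b → ⟦ a ⟧ + ⟦ b ⟧) Pi Pj) (+-≤-∑ (λ x → ⟦ P x ⟧) i≢j)

count-one-unique : ∀ {n} (P : Fin n → Bool) {i j} → count P ≡ 1 → P i ≡ true → P j ≡ true → i ≡ j
count-one-unique P {i} {j} one Pi Pj with i ≟ j
... | yes i≡j = i≡j
... | no  i≢j = ⊥-elim (1+n≰n (subst (2 ≤_) one (count-≥2 P i≢j Pi Pj)))

Unique : ∀ {n} → (Fin n → Bool) → Set
Unique P = ∀ i j → P i ≡ true → P j ≡ true → i ≡ j

count-unique : ∀ {n} (P : Fin n → Bool) → Unique P → count P ≤ ⟦ any P ⟧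
count-unique {zero}  P unique = z≤n
count-unique {suc n} P unique with P zero in P0
... | true  = ≤-reflexive (cong suc (count-false (P ∘ suc) rest))
  where
  rest : ∀ i → P (suc i) ≡ false
  rest i with P (suc i) in Pi
  ... | false = refl
  ... | true with unique zero (suc i) P0 Pi
  ... | ()
... | false = count-unique (P ∘ suc) λ i j Pi Pj → suc-injective (unique (suc i) (suc j) Pi Pj)

count-∧-unique : ∀ {n} c (P : Fin n → Bool) → Unique P → count (λ i → c ∧ P i) ≤ ⟦ c ∧ any P ⟧
count-∧-unique true  P unique = count-unique P unique
count-∧-unique {n} false P unique = ≤-reflexive (∑-zero n)

∑∑-distrib-+ : ∀ {m n} (f g : Fin m → Fin n → ℕ) →
  ∑ (λ u → ∑ λ v → f u v + g u v) ≡ ∑ (λ u → ∑ (f u)) + ∑ (λ u → ∑ (g u))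
∑∑-distrib-+ f g =
  trans (sum-cong-≗ (λ u → ∑-distrib-+ (f u) (g u))) (∑-distrib-+ (λ u → ∑ (f u)) (λ u → ∑ (g u)))

∑∑-mono : ∀ {m n} {f g : Fin m → Fin n → ℕ} → (∀ u v → f u v ≤ g u v) →
  ∑ (λ u → ∑ (f u)) ≤ ∑ (λ u → ∑ (g u))
∑∑-mono f≤g = ∑-mono (λ u → ∑-mono (f≤g u))

pairs-∨ : ∀ {n} (R S : Rel n) → pairs (λ u v → R u v ∨ S u v) ≤ pairs R + pairs S
pairs-∨ R S = begin
  pairs (λ u v → R u v ∨ S u v)                   ≤⟨ ∑∑-mono (λ u v → ⟦∨⟧≤ (R u v) (S u v)) ⟩
  ∑ (λ u → ∑ λ v → ⟦ R u v ⟧ + ⟦ S u v ⟧)         ≡⟨ ∑∑-distrib-+ (λ u v → ⟦ R u v ⟧) (λ u v → ⟦ S u v ⟧) ⟩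
  pairs R + pairs S                               ∎
  where open ≤-Reasoning

pairs-any : ∀ {n m} (R : Fin m → Rel n) → pairs (λ u v → any λ l → R l u v) ≤ ∑ λ l → pairs (R l)
pairs-any R = begin
  pairs (λ u v → any λ l → R l u v)               ≤⟨ ∑∑-mono (λ u v → ⟦any⟧≤count (λ l → R l u v)) ⟩
  ∑ (λ u → ∑ λ v → ∑ λ l → ⟦ R l u v ⟧)           ≡⟨ sum-cong-≗ (λ u → ∑-comm (λ v l → ⟦ R l u v ⟧)) ⟩
  ∑ (λ u → ∑ λ l → ∑ λ v → ⟦ R l u v ⟧)           ≡⟨ ∑-comm (λ u l → count (R l u)) ⟩
  ∑ (λ l → pairs (R l))                           ∎
  where open ≤-Reasoning

pairs-split : ∀ {n} (R S : Rel n) →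
  pairs R ≡ pairs (λ u v → R u v ∧ S u v) + pairs (λ u v → R u v ∧ not (S u v))
pairs-split R S = trans (sum-cong-≗ λ u → sum-cong-≗ λ v → ⟦⟧-split (R u v) (S u v))
                        (∑∑-distrib-+ (λ u v → ⟦ R u v ∧ S u v ⟧) (λ u v → ⟦ R u v ∧ not (S u v) ⟧))

link : ∀ {n} → Fin n → Fin n → Rel n
link p q u v = (u == p ∧ v == q) ∨ (u == q ∧ v == p)

==-unique : ∀ {n} (q : Fin n) → Unique (_== q)
==-unique q i j i≡q j≡q = trans (==-sound i≡q) (sym (==-sound j≡q))

pairs-point : ∀ {n} (p q : Fin n) → pairs (λ u v → u == p ∧ v == q) ≤ 1
pairs-point p q = begin
  pairs (λ u v → u == p ∧ v == q)
    ≤⟨ ∑-mono (λ u → count-∧-unique (u == p) (_== q) (==-unique q)) ⟩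
  ∑ (λ u → ⟦ u == p ∧ any (_== q) ⟧)
    ≤⟨ ∑-mono (λ u → ⟦∧⟧≤ˡ (u == p) _) ⟩
  count (_== p)
    ≤⟨ count-unique (_== p) (==-unique p) ⟩
  ⟦ any (_== p) ⟧
    ≤⟨ ⟦⟧≤1 _ ⟩
  1 ∎
  where open ≤-Reasoning

pairs-link : ∀ {n} (p q : Fin n) → pairs (link p q) ≤ 2
pairs-link p q = ≤-trans (pairs-∨ (λ u v → u == p ∧ v == q) (λ u v → u == q ∧ v == p))
                         (+-mono-≤ (pairs-point p q) (pairs-point q p))

<ᵇ-true : ∀ {m k} → m < k → (m <ᵇ k) ≡ true
<ᵇ-true m<k = Equivalence.to T-≡ (<⇒<ᵇ m<k)

<ᵇ-false : ∀ {m k} → k ≤ m → (m <ᵇ k) ≡ false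
<ᵇ-false {m} {k} k≤m with m <ᵇ k in m<ᵇk
... | false = refl
... | true  = ⊥-elim (<⇒≱ (<ᵇ⇒< m k (Equivalence.from T-≡ m<ᵇk)) k≤m)

module _ {n} {G : Graph n} (F : NonEdgeSet G) where

  mem-irrefl : ∀ u → mem F u u ≡ false
  mem-irrefl u with mem F u u in Fuu
  ... | false = refl
  ... | true  = ⊥-elim (proj₁ (nonEdge F u u Fuu) refl)

  ⟦mem⟧-by-order : ∀ u v →
    ⟦ mem F u v ⟧ ≡ ⟦ (toℕ u <ᵇ toℕ v) ∧ mem F u v ⟧ + ⟦ (toℕ v <ᵇ toℕ u) ∧ mem F u v ⟧
  ⟦mem⟧-by-order u v with <-cmp (toℕ u) (toℕ v)
  ... | tri< u<v _ _ rewrite <ᵇ-true u<v | <ᵇ-false {toℕ v} (<⇒≤ u<v) = sym (+-identityʳ _)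
  ... | tri> _ _ v<u rewrite <ᵇ-true v<u | <ᵇ-false {toℕ u} (<⇒≤ v<u) = refl
  ... | tri≈ _ u≡v _ rewrite toℕ-injective u≡v | mem-irrefl v | ∧-zeroʳ (toℕ v <ᵇ toℕ v) = refl

  pairs-mem : pairs (mem F) ≡ 2 * size F
  pairs-mem = begin
    pairs (mem F)
      ≡⟨ sum-cong-≗ (λ u → sum-cong-≗ (⟦mem⟧-by-order u)) ⟩
    ∑ (λ u → ∑ λ v → ⟦ u < v ⟧ᶠ + ⟦ u > v ⟧ᶠ)
      ≡⟨ ∑∑-distrib-+ (λ u v → ⟦ u < v ⟧ᶠ) (λ u v → ⟦ u > v ⟧ᶠ) ⟩
    below + ∑ (λ u → ∑ λ v → ⟦ u > v ⟧ᶠ)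
      ≡⟨ cong (below +_) (∑-comm (λ u v → ⟦ u > v ⟧ᶠ)) ⟩
    below + ∑ (λ v → ∑ λ u → ⟦ u > v ⟧ᶠ)
      ≡⟨ cong (below +_) (sum-cong-≗ λ v → sum-cong-≗ λ u →
           cong (λ b → ⟦ (toℕ v <ᵇ toℕ u) ∧ b ⟧) (memSym F u v)) ⟩
    below + below
      ≡⟨ cong (below +_) (+-identityʳ below) ⟨
    2 * below
      ≡⟨ cong (2 *_) size-as-pairs ⟨
    2 * size F ∎
    where
    open ≡-Reasoning
    ⟦_<_⟧ᶠ ⟦_>_⟧ᶠ : Fin n → Fin n → ℕ
    ⟦ u < v ⟧ᶠ = ⟦ (toℕ u <ᵇ toℕ v) ∧ mem F u v ⟧
    ⟦ u > v ⟧ᶠ = ⟦ (toℕ v <ᵇ toℕ u) ∧ mem F u v ⟧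
    below : ℕ
    below = ∑ λ u → ∑ λ v → ⟦ u < v ⟧ᶠ
    size-as-pairs : size F ≡ below
    size-as-pairs = trans (sum-tabulate {n} _) (sum-cong-≗ {n} λ u → sum-tabulate {n} _)

three-in-two : ∀ {A : Set} {a b c v w : A} → a ≢ b → a ≢ c → b ≢ c →
  a ≡ v ⊎ a ≡ w → b ≡ v ⊎ b ≡ w → c ≡ v ⊎ c ≡ w → ⊥
three-in-two a≢b _   _   (inj₁ refl) (inj₁ refl) _           = a≢b refl
three-in-two a≢b _   _   (inj₂ refl) (inj₂ refl) _           = a≢b refl
three-in-two _   a≢c _   (inj₁ refl) (inj₂ refl) (inj₁ refl) = a≢c refl
three-in-two _   _   b≢c (inj₁ refl) (inj₂ refl) (inj₂ refl) = b≢c refl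
three-in-two _   _   b≢c (inj₂ refl) (inj₁ refl) (inj₁ refl) = b≢c refl
three-in-two _   a≢c _   (inj₂ refl) (inj₁ refl) (inj₂ refl) = a≢c refl

module _ {n} {G : Graph n} where

  walk-++ : ∀ {u w v k m} → Walk G u w k → Walk G w v m → Walk G u v (k + m)
  walk-++ (here _)        q = q
  walk-++ (step uw p)     q = step uw (walk-++ p q)

  walk-reverse : ∀ {u v k} → Walk G u v k → Walk G v u k
  walk-reverse (here v) = here v
  walk-reverse {k = suc k} (step {u = u} {w} uw p) =
    subst (Walk G _ u) (+-comm k 1) (walk-++ (walk-reverse p) (step (trans (adj-sym G w u) uw) (here u)))

  walk-exits : ∀ (S : Fin n → Bool) {u v k} → Walk G u v k → S u ≡ true → S v ≡ false →
    ∃[ x ] ∃[ y ] S x ≡ true × S y ≡ false × adj G x y ≡ true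
  walk-exits S (here _) Su Sv = ⊥-elim (true≢false Su Sv)
  walk-exits S (step {u = u} {w} uw p) Su Sv with S w in Sw
  ... | false = u , w , Su , Sw , uw
  ... | true  = walk-exits S p Sw Sv

  reachable-avoiding : ComponentsAtLeast3 G → ∀ v w → ∃[ y ] ¬ (y ≡ v ⊎ y ≡ w) × Connected G v y
  reachable-avoiding c3 v w with c3 v
  ... | a , b , c , a≢b , a≢c , b≢c , va , vb , vc
    with (a ≟ v) ⊎-dec (a ≟ w) | (b ≟ v) ⊎-dec (b ≟ w) | (c ≟ v) ⊎-dec (c ≟ w)
  ... | no a∉ | _     | _     = a , a∉ , va
  ... | yes _ | no b∉ | _     = b , b∉ , vb
  ... | yes _ | yes _ | no c∉ = c , c∉ , vc
  ... | yes a∈ | yes b∈ | yes c∈ = ⊥-elim (three-in-two a≢b a≢c b≢c a∈ b∈ c∈)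

  escape : ComponentsAtLeast3 G → ∀ v w →
    ∃[ x ] ¬ (x ≡ v ⊎ x ≡ w) × (adj G v x ≡ true ⊎ adj G w x ≡ true)
  escape c3 v w with reachable-avoiding c3 v w
  ... | y , y∉ , k , v⇝y with walk-exits (λ x → x == v ∨ x == w) v⇝y (∨-introˡ _ (==-refl v)) y∉ᵇ
    where
    y∉ᵇ : (y == v ∨ y == w) ≡ false
    y∉ᵇ = cong₂ _∨_ (dec-false (y ≟ v) (y∉ ∘ inj₁)) (dec-false (y ≟ w) (y∉ ∘ inj₂))
  ... | x , x′ , x∈ , x′∉ , xx′ = x′ , x′∉ᵖ , side (∨-elim x∈)
    where
    x′∉ᵖ : ¬ (x′ ≡ v ⊎ x′ ≡ w)
    x′∉ᵖ (inj₁ refl) = true≢false (∨-introˡ _ (==-refl v)) x′∉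
    x′∉ᵖ (inj₂ refl) = true≢false (∨-introʳ (x′ == v) (==-refl w)) x′∉
    side : x == v ≡ true ⊎ x == w ≡ true → adj G v x′ ≡ true ⊎ adj G w x′ ≡ true
    side (inj₁ x≡v) = inj₁ (subst (λ z → adj G z x′ ≡ true) (==-sound x≡v) xx′)
    side (inj₂ x≡w) = inj₂ (subst (λ z → adj G z x′ ≡ true) (==-sound x≡w) xx′)

link-sym : ∀ {n} (p q a b : Fin n) → link p q a b ≡ link p q b a
link-sym p q a b = trans (∨-comm (a == p ∧ b == q) _) (cong₂ _∨_ (∧-comm (a == q) _) (∧-comm (a == p) _))

link-elim : ∀ {n} {p q a b : Fin n} → link p q a b ≡ true → (a ≡ p × b ≡ q) ⊎ (a ≡ q × b ≡ p)
link-elim {a = a} {b} ab with ∨-elim {a == _ ∧ b == _} ab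
... | inj₁ ab=pq = let a=p , b=q = ∧-elim ab=pq in inj₁ (==-sound a=p , ==-sound b=q)
... | inj₂ ab=qp = let a=q , b=p = ∧-elim ab=qp in inj₂ (==-sound a=q , ==-sound b=p)

link-self : ∀ {n} (p q : Fin n) → link p q p q ≡ true
link-self p q = ∨-introˡ _ (∧-intro (==-refl p) (==-refl q))

-- apex u v lies outside {u, v} and is G-adjacent to u or v (to u when u v is a non-edge);
-- closing u v consists of the at most one non-edge completing the triangle u v (apex u v).
module Apex {n} (G : Graph n) (c3 : ComponentsAtLeast3 G) where

  neighbour : Fin n → Fin n
  neighbour v = proj₁ (escape c3 v v)

  neighbour-adj : ∀ v → adj G v (neighbour v) ≡ true
  neighbour-adj v = reduce (proj₂ (proj₂ (escape c3 v v)))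

  apex : Fin n → Fin n → Fin n
  apex u v = if adj G u v then proj₁ (escape c3 u v) else neighbour u

  apex-fresh : ∀ u v → ¬ (apex u v ≡ u ⊎ apex u v ≡ v)
  apex-fresh u v with adj G u v in uv
  ... | true  = proj₁ (proj₂ (escape c3 u v))
  ... | false = λ where
    (inj₁ x≡u) → true≢false (subst (λ x → adj G u x ≡ true) x≡u (neighbour-adj u)) (irrefl G u)
    (inj₂ x≡v) → true≢false (subst (λ x → adj G u x ≡ true) x≡v (neighbour-adj u)) uv

  apex-adj : ∀ u v → adj G u (apex u v) ≡ true ⊎ adj G v (apex u v) ≡ true
  apex-adj u v with adj G u v
  ... | true  = proj₂ (proj₂ (escape c3 u v))
  ... | false = inj₁ (neighbour-adj u)

  newEdge : Fin n → Fin n → Rel n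
  newEdge p q a b = not (adj G p q) ∧ link p q a b

  newEdge-nonEdge : ∀ {p q a b} → p ≢ q → newEdge p q a b ≡ true → a ≢ b × adj G a b ≡ false
  newEdge-nonEdge {p} {q} {a} {b} p≢q e with ∧-elim {not (adj G p q)} e
  ... | ¬pq , ab with link-elim {p = p} {q} {a} {b} ab
  ...   | inj₁ (refl , refl) = p≢q , not-elim ¬pq
  ...   | inj₂ (refl , refl) = p≢q ∘ sym , trans (adj-sym G q p) (not-elim ¬pq)

  newEdge-or-adj : ∀ p q → adj G p q ≡ true ⊎ newEdge p q p q ≡ true
  newEdge-or-adj p q with adj G p q
  ... | true  = inj₁ refl
  ... | false = inj₂ (link-self p q)

  gap : Fin n → Fin n → Fin n
  gap u v = if adj G u (apex u v) then v else u

  gap-cases : ∀ u v →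
    (adj G u (apex u v) ≡ true × gap u v ≡ v) ⊎ (adj G v (apex u v) ≡ true × gap u v ≡ u)
  gap-cases u v with adj G u (apex u v) in ux
  ... | true  = inj₁ (refl , refl)
  ... | false with apex-adj u v
  ...   | inj₁ ux′ = ⊥-elim (true≢false ux′ ux)
  ...   | inj₂ vx  = inj₂ (vx , refl)

  closing : Fin n → Fin n → Rel n
  closing u v = newEdge (gap u v) (apex u v)

  closing-sym : ∀ u v a b → closing u v a b ≡ closing u v b a
  closing-sym u v a b = cong (not (adj G (gap u v) (apex u v)) ∧_) (link-sym (gap u v) (apex u v) a b)

  closing-nonEdge : ∀ u v {a b} → closing u v a b ≡ true → a ≢ b × adj G a b ≡ false
  closing-nonEdge u v = newEdge-nonEdge gap≢apex
    where
    gap≢apex : gap u v ≢ apex u v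
    gap≢apex g≡x with gap-cases u v
    ... | inj₁ (_ , g≡v) = apex-fresh u v (inj₂ (trans (sym g≡x) g≡v))
    ... | inj₂ (_ , g≡u) = apex-fresh u v (inj₁ (trans (sym g≡x) g≡u))

  pairs-closing : ∀ u v → pairs (closing u v) ≤ 2
  pairs-closing u v =
    ≤-trans (∑∑-mono {n} {n} λ a b → ⟦∧⟧≤ʳ _ (link _ _ a b)) (pairs-link (gap u v) (apex u v))

  closing-triangle : ∀ (R : Rel n) u v → (∀ a b → adj G a b ≡ true → R a b ≡ true) →
    (∀ a b → closing u v a b ≡ true → R a b ≡ true) → R u (apex u v) ≡ true × R v (apex u v) ≡ true
  closing-triangle R u v adj⊆R closing⊆R = sides (gap-cases u v)
    where
    x = apex u v
    filled : R (gap u v) x ≡ true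
    filled = [ adj⊆R _ _ , closing⊆R _ _ ]′ (newEdge-or-adj (gap u v) x)
    sides : (adj G u x ≡ true × gap u v ≡ v) ⊎ (adj G v x ≡ true × gap u v ≡ u) →
            R u x ≡ true × R v x ≡ true
    sides (inj₁ (ux , g≡v)) = adj⊆R _ _ ux , subst (λ p → R p x ≡ true) g≡v filled
    sides (inj₂ (vx , g≡u)) = subst (λ p → R p x ≡ true) g≡u filled , adj⊆R _ _ vx

module Separated {n t} (G : Graph n) (X : Fin t → Subset n)
  (far : ∀ i j → i ≢ j → DistAtLeast G (X i) (X j) 3) where

  centre : Fin t → Fin n → Bool
  centre i v = lookup (X i) v

  ball : Fin t → Fin n → Bool
  ball i v = centre i v ∨ any (λ x → centre i x ∧ adj G x v)

  centre⇒ball : ∀ {i v} → centre i v ≡ true → ball i v ≡ true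
  centre⇒ball = ∨-introˡ _

  centre-adj⇒ball : ∀ {i v x} → centre i v ≡ true → adj G v x ≡ true → ball i x ≡ true
  centre-adj⇒ball {i} {v} {x} iv vx = ∨-introʳ (centre i x) (any-intro _ v (∧-intro iv vx))

  ball-walk : ∀ {i v} → ball i v ≡ true → ∃[ x ] centre i x ≡ true × ∃[ k ] k ≤ 1 × Walk G x v k
  ball-walk {i} {v} iv with ∨-elim {centre i v} iv
  ... | inj₁ centre-v = v , centre-v , 0 , z≤n , here v
  ... | inj₂ near with any-elim _ near
  ... | x , ix-xv = let ix , xv = ∧-elim ix-xv in x , ix , 1 , ≤-refl , step xv (here v)

  centres-close : ∀ {i j x y k} → centre i x ≡ true → centre j y ≡ true → Walk G x y k → k ≤ 2 → i ≡ j
  centres-close {i} {j} {x} {y} {k} ix jy x⇝y k≤2 with i ≟ j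
  ... | yes i≡j = i≡j
  ... | no  i≢j =
    ⊥-elim (<⇒≱ (s≤s k≤2) (far i j i≢j x y k (lookup⇒[]= x (X i) ix) (lookup⇒[]= y (X j) jy) x⇝y))

  balls-disjoint : ∀ {i j v} → ball i v ≡ true → ball j v ≡ true → i ≡ j
  balls-disjoint iv jv with ball-walk iv | ball-walk jv
  ... | x , ix , k , k≤1 , x⇝v | y , jy , m , m≤1 , y⇝v =
    centres-close ix jy (walk-++ x⇝v (walk-reverse y⇝v)) (+-mono-≤ k≤1 m≤1)

  ball-centre-adj : ∀ {i j a b} → ball i a ≡ true → centre j b ≡ true → adj G a b ≡ true → i ≡ j
  ball-centre-adj ia jb ab with ball-walk ia
  ... | x , ix , k , k≤1 , x⇝a =
    centres-close ix jb (walk-++ x⇝a (step ab (here _))) (+-mono-≤ k≤1 (≤-refl {1}))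

  module Completion (F : NonEdgeSet G) (Δ : IsΔCompletion G F) where

    E⁺ : Rel n
    E⁺ = adjPlus G F

    E⁺-sym : ∀ u v → E⁺ u v ≡ E⁺ v u
    E⁺-sym u v = cong₂ _∨_ (adj-sym G u v) (memSym F u v)

    E⁺⇒≢ : ∀ {u v} → E⁺ u v ≡ true → u ≢ v
    E⁺⇒≢ {u} uv refl = true≢false uv (cong₂ _∨_ (irrefl G u) (mem-irrefl F u))

    sameBall : Rel n
    sameBall u v = any λ i → ball i u ∧ ball i v

    sameBall-sym : ∀ u v → sameBall u v ≡ sameBall v u
    sameBall-sym u v = any-cong λ i → ∧-comm (ball i u) (ball i v)

    sameBall-intro : ∀ {i u v} → ball i u ≡ true → ball i v ≡ true → sameBall u v ≡ true
    sameBall-intro {i} iu iv = any-intro _ i (∧-intro iu iv)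

    sameBall-elim : ∀ {i u v} → ball i u ≡ true → sameBall u v ≡ true → ball i v ≡ true
    sameBall-elim {i} {u} {v} iu same with any-elim (λ k → ball k u ∧ ball k v) same
    ... | k , ku-kv = let ku , kv = ∧-elim {ball k u} ku-kv in
      subst (λ j → ball j v ≡ true) (sym (balls-disjoint iu ku)) kv

    outside-ball : ∀ {i u v} → ball i u ≡ true → sameBall u v ≡ false → ball i v ≡ false
    outside-ball iu apart = ¬-not λ iv → true≢false (sameBall-intro iu iv) apart

    sameBall-false : ∀ {i u v} → ball i u ≡ true → ball i v ≡ false → sameBall u v ≡ false
    sameBall-false iu iv = ¬-not λ same → true≢false (sameBall-elim iu same) iv

    local : Fin t → Rel n
    local i u v = mem F u v ∧ (ball i u ∧ ball i v)

    internal external : Rel n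
    internal u v = mem F u v ∧ sameBall u v
    external u v = mem F u v ∧ not (sameBall u v)

    external-sym : ∀ u v → external u v ≡ external v u
    external-sym u v = cong₂ (λ a b → a ∧ not b) (memSym F u v) (sameBall-sym u v)

    external-from-centre : ∀ {i v x} → centre i v ≡ true → ball i x ≡ false → E⁺ v x ≡ true →
      external v x ≡ true
    external-from-centre {i} {v} {x} iv ix vx with ∨-elim vx
    ... | inj₁ adj-vx = ⊥-elim (true≢false (centre-adj⇒ball iv adj-vx) ix)
    ... | inj₂ F-vx   = ∧-intro F-vx (not-intro (sameBall-false (centre⇒ball iv) ix))

    tri₁ tri₂ : Fin n → Fin n
    tri₁ v = proj₁ (Δ v)
    tri₂ v = proj₁ (proj₂ (Δ v))

    -- β v and β̄ v are the other two vertices of v's triangle; β v shares a ball with v if either does.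
    β β̄ : Fin n → Fin n
    β v = if sameBall v (tri₁ v) then tri₁ v else tri₂ v
    β̄ v = if sameBall v (tri₁ v) then tri₂ v else tri₁ v

    β-triangle : ∀ v → E⁺ v (β v) ≡ true × E⁺ v (β̄ v) ≡ true × E⁺ (β v) (β̄ v) ≡ true
    β-triangle v with sameBall v (tri₁ v) | proj₂ (proj₂ (Δ v))
    ... | true  | v₁ , v₂ , t₁₂ = v₁ , v₂ , t₁₂
    ... | false | v₁ , v₂ , t₁₂ = v₂ , v₁ , trans (E⁺-sym _ _) t₁₂

    β≢β̄ : ∀ v → β v ≢ β̄ v
    β≢β̄ v = E⁺⇒≢ (proj₂ (proj₂ (β-triangle v)))

    β≢ : ∀ v → β v ≢ v
    β≢ v β≡v = E⁺⇒≢ (proj₁ (β-triangle v)) (sym β≡v)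

    bad : Fin n → Bool
    bad v = any (λ i → centre i v) ∧ not (sameBall v (tri₁ v) ∧ sameBall v (tri₂ v))

    bad-centre : ∀ {v} → bad v ≡ true → ∃[ i ] centre i v ≡ true
    bad-centre bv = any-elim _ (proj₁ (∧-elim bv))

    good-triangle : ∀ {i v} → centre i v ≡ true → bad v ≡ false →
      ball i (tri₁ v) ≡ true × ball i (tri₂ v) ≡ true
    good-triangle {i} {v} iv good =
      let s₁ , s₂ = ∧-elim {sameBall v (tri₁ v)} (∧-not-false (any-intro (λ k → centre k v) i iv) good)
      in sameBall-elim (centre⇒ball iv) s₁ , sameBall-elim (centre⇒ball iv) s₂

    bad-β̄ : ∀ {i v} → centre i v ≡ true → bad v ≡ true → ball i (β̄ v) ≡ false
    bad-β̄ {i} {v} iv bv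
      with sameBall v (tri₁ v) in s₁ | not-elim (proj₂ (∧-elim {any (λ k → centre k v)} bv))
    ... | true  | s₂ = outside-ball (centre⇒ball iv) s₂
    ... | false | _  = outside-ball (centre⇒ball iv) s₁

    bad-external : ∀ {i v} → centre i v ≡ true → bad v ≡ true → external v (β̄ v) ≡ true
    bad-external iv bv = external-from-centre iv (bad-β̄ iv bv) (proj₁ (proj₂ (β-triangle _)))

    degree : Fin n → ℕ
    degree v = count (external v)

    -- For a bad vertex, β̄ v is an external neighbour; a leaf has no other external edge.
    leaf : Fin n → Bool
    leaf v = bad v ∧ (does (degree v ≟ℕ 1) ∧ bad (β̄ v))

    leaf-elim : ∀ {v} → leaf v ≡ true → bad v ≡ true × degree v ≡ 1 × bad (β̄ v) ≡ true
    leaf-elim {v} lv =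
      let bv , rest = ∧-elim {bad v} lv ; d≡1 , bβ̄ = ∧-elim {does (degree v ≟ℕ 1)} rest
      in bv , does-sound (degree v ≟ℕ 1) d≡1 , bβ̄

    leaf-neighbour : ∀ {l y} → leaf l ≡ true → external l y ≡ true → y ≡ β̄ l
    leaf-neighbour {l} ll ly with leaf-elim ll
    ... | bl , d≡1 , _ = count-one-unique (external l) d≡1 ly (bad-external (proj₂ (bad-centre bl)) bl)

    leaf-β-ball : ∀ {i l} → centre i l ≡ true → leaf l ≡ true → ball i (β l) ≡ true
    leaf-β-ball {i} {l} il ll with ball i (β l) in iβ
    ... | true  = refl
    ... | false = ⊥-elim (β≢β̄ l (leaf-neighbour ll (external-from-centre il iβ (proj₁ (β-triangle l)))))

    leaf-link : ∀ {l} → leaf l ≡ true → external (β̄ l) (β l) ≡ true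
    leaf-link {l} ll with leaf-elim ll
    ... | bl , _ , bβ̄ with bad-centre bl | bad-centre bβ̄
    ... | i , il | j , jβ̄ = ∧-intro F-edge (not-intro apart)
      where
      iβ : ball i (β l) ≡ true
      iβ = leaf-β-ball il ll
      i≢j : i ≢ j
      i≢j refl = true≢false (centre⇒ball jβ̄) (bad-β̄ il bl)
      F-edge : mem F (β̄ l) (β l) ≡ true
      F-edge with ∨-elim (trans (E⁺-sym (β̄ l) (β l)) (proj₂ (proj₂ (β-triangle l))))
      ... | inj₁ adj-β̄β = ⊥-elim (i≢j (ball-centre-adj iβ jβ̄ (trans (adj-sym G (β l) (β̄ l)) adj-β̄β)))
      ... | inj₂ F-β̄β   = F-β̄β
      apart : sameBall (β̄ l) (β l) ≡ false
      apart = ¬-not λ same → i≢j (balls-disjoint iβ (sameBall-elim (centre⇒ball jβ̄) same))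

    -- rep b is a canonical leaf whose external neighbour is b.  Its partner β (rep b) is repaired
    -- together with it, so the covered vertices are left out of D.
    leafAt : Fin n → Fin n → Bool
    leafAt b l = leaf l ∧ β̄ l == b

    rep : Fin n → Maybe (Fin n)
    rep b = find (leafAt b)

    rep-leaf : ∀ {b m} → rep b ≡ just m → leaf m ≡ true × β̄ m ≡ b
    rep-leaf {b} {m} eq = let lm , at = ∧-elim {leaf m} (find-sound (leafAt b) eq) in lm , ==-sound at

    rep-exists : ∀ {l} → leaf l ≡ true → ∃[ m ] rep (β̄ l) ≡ just m
    rep-exists {l} ll = find-complete (leafAt (β̄ l)) l (∧-intro ll (==-refl (β̄ l)))

    covered : Fin n → Bool
    covered z = any λ b → maybe (λ m → β m == z) false (rep b)

    covered-intro : ∀ {b m} → rep b ≡ just m → covered (β m) ≡ true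
    covered-intro {b} {m} eq =
      any-intro _ b (subst (λ r → maybe (λ m′ → β m′ == β m) false r ≡ true) (sym eq) (==-refl (β m)))

    covered-elim : ∀ {z} → covered z ≡ true → ∃[ b ] ∃[ m ] rep b ≡ just m × β m ≡ z
    covered-elim {z} cz with any-elim (λ b → maybe (λ m → β m == z) false (rep b)) cz
    ... | b , paired with rep b in eq
    ...   | just m = b , m , eq , ==-sound paired

    D : Fin n → Bool
    D v = bad v ∧ not (covered v)

    rep-D : ∀ {b m} → rep b ≡ just m → D m ≡ true
    rep-D {b} {m} eq with rep-leaf eq
    ... | lm , β̄m≡b = ∧-intro (proj₁ (leaf-elim lm)) (not-intro (¬-not uncovered))
      where
      uncovered : covered m ≡ true → ⊥
      uncovered cm with covered-elim cm
      ... | b′ , m′ , eq′ , βm′≡m = β≢ m (trans (cong β m≡m′) βm′≡m)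
        where
        b′m : external b′ m ≡ true
        b′m = subst₂ (λ x y → external x y ≡ true) (proj₂ (rep-leaf eq′)) βm′≡m
                     (leaf-link (proj₁ (rep-leaf eq′)))
        b′≡b : b′ ≡ b
        b′≡b = trans (leaf-neighbour lm (trans (external-sym m b′) b′m)) β̄m≡b
        m≡m′ : m ≡ m′
        m≡m′ = just-injective (trans (sym eq) (trans (cong rep (sym b′≡b)) eq′))

    rep-partner-not-D : ∀ {b m} → rep b ≡ just m → D (β m) ≡ false
    rep-partner-not-D {m = m} eq = trans (cong (λ c → bad (β m) ∧ not c) (covered-intro eq)) (∧-zeroʳ _)

    -- Discharging on the external edges: v starts with one unit per external edge at v, plus the
    -- unit of the other end when that end is not in D (initial); then every D-leaf takes one unit
    -- from its D-neighbour (transfer).  Each vertex of D ends up with at least two units.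
    initial : Fin n → ℕ
    initial v = ∑ λ y → ⟦ D v ∧ external v y ⟧ + ⟦ D v ∧ (external v y ∧ not (D y)) ⟧

    transfer : Rel n
    transfer l v = D v ∧ (D l ∧ (leaf l ∧ external l v))

    sent received : Fin n → ℕ
    sent v     = count λ l → transfer l v
    received l = count (transfer l)

    transfer-elim : ∀ {l v} → transfer l v ≡ true →
      D v ≡ true × D l ≡ true × leaf l ≡ true × external l v ≡ true
    transfer-elim {l} {v} t =
      let Dv , t′ = ∧-elim {D v} t ; Dl , t″ = ∧-elim {D l} t′ ; ll , lv = ∧-elim {leaf l} t″
      in Dv , Dl , ll , lv

    initial-total : ∑ initial ≤ pairs external
    initial-total = begin
      ∑ initial
        ≡⟨ ∑∑-distrib-+ own shared ⟩
      ∑ (λ v → ∑ (own v)) + ∑ (λ v → ∑ (shared v))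
        ≡⟨ cong (∑ (λ v → ∑ (own v)) +_) (∑-comm shared) ⟩
      ∑ (λ v → ∑ (own v)) + ∑ (λ v → ∑ λ y → shared y v)
        ≡⟨ cong (∑ (λ v → ∑ (own v)) +_) (sum-cong-≗ λ v → sum-cong-≗ λ y →
             cong (λ e → ⟦ D y ∧ (e ∧ not (D v)) ⟧) (external-sym y v)) ⟩
      ∑ (λ v → ∑ (own v)) + ∑ (λ v → ∑ λ y → ⟦ D y ∧ (external v y ∧ not (D v)) ⟧)
        ≡⟨ ∑∑-distrib-+ own (λ v y → ⟦ D y ∧ (external v y ∧ not (D v)) ⟧) ⟨
      ∑ (λ v → ∑ λ y → own v y + ⟦ D y ∧ (external v y ∧ not (D v)) ⟧)
        ≤⟨ ∑∑-mono (λ v y → ⟦⟧-shared-edge (D v) (D y) (external v y)) ⟩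
      pairs external ∎
      where
      open ≤-Reasoning
      own shared : Fin n → Fin n → ℕ
      own v y    = ⟦ D v ∧ external v y ⟧
      shared v y = ⟦ D v ∧ (external v y ∧ not (D y)) ⟧
      ⟦⟧-shared-edge : ∀ a b e → ⟦ a ∧ e ⟧ + ⟦ b ∧ (e ∧ not a) ⟧ ≤ ⟦ e ⟧
      ⟦⟧-shared-edge true  true  true  = ≤-refl
      ⟦⟧-shared-edge true  false true  = ≤-refl
      ⟦⟧-shared-edge false true  true  = ≤-refl
      ⟦⟧-shared-edge false false true  = z≤n
      ⟦⟧-shared-edge true  b     false = ≤-reflexive (cong ⟦_⟧ (∧-zeroʳ b))
      ⟦⟧-shared-edge false b     false = ≤-reflexive (cong ⟦_⟧ (∧-zeroʳ b))

    sent-of-non-D : ∀ {v} → D v ≡ false → sent v ≡ 0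
    sent-of-non-D {v} Dv = count-false _ λ l → cong (_∧ (D l ∧ (leaf l ∧ external l v))) Dv

    degree≤initial : ∀ {v} → D v ≡ true → degree v ≤ initial v
    degree≤initial {v} Dv = ∑-mono λ y →
      subst (λ a → ⟦ external v y ⟧ ≤ ⟦ a ∧ external v y ⟧ + ⟦ a ∧ (external v y ∧ not (D y)) ⟧)
            (sym Dv) (m≤m+n _ _)

    leaf-sends-nothing : ∀ {v} → leaf v ≡ true → ∀ l → transfer l v ≡ false
    leaf-sends-nothing {v} lv l = ¬-not λ t →
      let _ , _ , ll , lv-edge = transfer-elim t
          vβ : external v (β l) ≡ true
          vβ = subst (λ x → external x (β l) ≡ true) (sym (leaf-neighbour ll lv-edge)) (leaf-link ll)
      in 1+n≰n (subst (2 ≤_) (proj₁ (proj₂ (leaf-elim lv)))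
                  (count-≥2 (external v) (β≢ l) vβ (trans (external-sym v l) lv-edge)))

    leaf-balance : ∀ {v} → D v ≡ true → leaf v ≡ true → 2 + sent v ≤ initial v + received v
    leaf-balance {v} Dv lv = begin
      2 + sent v                 ≡⟨ cong (2 +_) (count-false _ (leaf-sends-nothing lv)) ⟩
      2                          ≡⟨ cong (λ d → d + d) (proj₁ (proj₂ (leaf-elim lv))) ⟨
      degree v + degree v        ≡⟨ ∑-distrib-+ (λ y → ⟦ external v y ⟧) (λ y → ⟦ external v y ⟧) ⟨
      ∑ (λ y → ⟦ external v y ⟧ + ⟦ external v y ⟧)
        ≡⟨ sum-cong-≗ (λ y → ⟦⟧-leaf-edge (D v) (leaf v) (D y) (external v y) Dv lv) ⟨
      ∑ (λ y → (⟦ D v ∧ external v y ⟧ + ⟦ D v ∧ (external v y ∧ not (D y)) ⟧)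
               + ⟦ D y ∧ (D v ∧ (leaf v ∧ external v y)) ⟧)
        ≡⟨ ∑-distrib-+ (λ y → ⟦ D v ∧ external v y ⟧ + ⟦ D v ∧ (external v y ∧ not (D y)) ⟧)
                       (λ y → ⟦ transfer v y ⟧) ⟩
      initial v + received v     ∎
      where
      open ≤-Reasoning
      ⟦⟧-leaf-edge : ∀ a c d e → a ≡ true → c ≡ true →
        (⟦ a ∧ e ⟧ + ⟦ a ∧ (e ∧ not d) ⟧) + ⟦ d ∧ (a ∧ (c ∧ e)) ⟧ ≡ ⟦ e ⟧ + ⟦ e ⟧
      ⟦⟧-leaf-edge .true .true true  true  refl refl = refl
      ⟦⟧-leaf-edge .true .true false true  refl refl = refl
      ⟦⟧-leaf-edge .true .true true  false refl refl = refl
      ⟦⟧-leaf-edge .true .true false false refl refl = refl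

    giver-bound : ∀ {v z} → D v ≡ true → external v z ≡ true → D z ≡ false → sent v + 2 ≤ initial v
    giver-bound {v} {z} Dv vz Dz = ∑-mono-slack z pointwise at-z
      where
      ⟦⟧-transfer≤ : ∀ a b c d → ⟦ a ∧ (b ∧ (c ∧ d)) ⟧ ≤ ⟦ a ∧ d ⟧
      ⟦⟧-transfer≤ true true true d = ≤-refl
      ⟦⟧-transfer≤ true true false d = z≤n
      ⟦⟧-transfer≤ true false c d = z≤n
      ⟦⟧-transfer≤ false b c d = z≤n
      pointwise : ∀ y → ⟦ transfer y v ⟧ ≤ ⟦ D v ∧ external v y ⟧ + ⟦ D v ∧ (external v y ∧ not (D y)) ⟧
      pointwise y = ≤-trans (≤-trans (⟦⟧-transfer≤ (D v) (D y) (leaf y) _)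
                                     (≤-reflexive (cong (λ e → ⟦ D v ∧ e ⟧) (external-sym y v))))
                            (m≤m+n _ _)
      at-z : ⟦ transfer z v ⟧ + 2 ≤ ⟦ D v ∧ external v z ⟧ + ⟦ D v ∧ (external v z ∧ not (D z)) ⟧
      at-z rewrite Dv | Dz | vz = ≤-refl

    transfer-source : ∀ {l v} → transfer l v ≡ true → ∃[ z ] external v z ≡ true × D z ≡ false
    transfer-source {l} {v} t with transfer-elim t
    ... | _ , _ , ll , lv-edge with rep-exists ll
    ... | m , eq = β m , vβm , rep-partner-not-D eq
      where
      β̄m≡v : β̄ m ≡ v
      β̄m≡v = trans (proj₂ (rep-leaf eq)) (sym (leaf-neighbour ll lv-edge))
      vβm : external v (β m) ≡ true
      vβm = subst (λ x → external x (β m) ≡ true) β̄m≡v (leaf-link (proj₁ (rep-leaf eq)))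

    nonleaf-balance : ∀ {v} → D v ≡ true → leaf v ≡ false → 2 + sent v ≤ initial v
    nonleaf-balance {v} Dv lv with ∧-elim {bad v} Dv
    ... | bv , _ with D (β̄ v) in Dβ̄ | bad-centre bv
    ... | false | i , iv = subst (_≤ initial v) (+-comm (sent v) 2) (giver-bound Dv (bad-external iv bv) Dβ̄)
    ... | true  | i , iv with any? (λ l → transfer l v ≟ᵇ true)
    ...   | yes (l , t) = let z , vz , Dz = transfer-source t in
                          subst (_≤ initial v) (+-comm (sent v) 2) (giver-bound Dv vz Dz)
    ...   | no none = begin
      2 + sent v   ≡⟨ cong (2 +_) (count-false _ λ l → ¬-not λ t → none (l , t)) ⟩
      2            ≤⟨ ≤∧≢⇒< (count-≥1 (external v) (bad-external iv bv)) (λ 1≡d → not-leaf (sym 1≡d)) ⟩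
      degree v     ≤⟨ degree≤initial Dv ⟩
      initial v    ∎
      where
      open ≤-Reasoning
      not-leaf : degree v ≢ 1
      not-leaf d≡1 =
        true≢false (∧-intro bv (∧-intro (dec-true (degree v ≟ℕ 1) d≡1) (proj₁ (∧-elim {bad (β̄ v)} Dβ̄)))) lv

    D-balance : ∀ {v} → D v ≡ true → 2 + sent v ≤ initial v + received v
    D-balance {v} Dv with leaf v ≟ᵇ true
    ... | yes lv  = leaf-balance Dv lv
    ... | no  ¬lv = ≤-trans (nonleaf-balance Dv (¬-not ¬lv)) (m≤m+n _ _)

    balance : ∀ v → 2 * ⟦ D v ⟧ + sent v ≤ initial v + received v
    balance v with D v ≟ᵇ true
    ... | yes Dv  = subst (λ b → 2 * ⟦ b ⟧ + sent v ≤ initial v + received v) (sym Dv) (D-balance Dv)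
    ... | no  ¬Dv =
      ≤-trans (≤-reflexive (cong₂ (λ b s → 2 * ⟦ b ⟧ + s) (¬-not ¬Dv) (sent-of-non-D (¬-not ¬Dv)))) z≤n

    D-bound : 2 * count D ≤ pairs external
    D-bound = ≤-trans (+-cancelʳ-≤ (∑ sent) _ _ summed) initial-total
      where
      open ≤-Reasoning
      summed : 2 * count D + ∑ sent ≤ ∑ initial + ∑ sent
      summed = begin
        2 * count D + ∑ sent                     ≡⟨ cong (_+ ∑ sent) (*-distribˡ-sum 2 (λ v → ⟦ D v ⟧)) ⟩
        ∑ (λ v → 2 * ⟦ D v ⟧) + ∑ sent           ≡⟨ ∑-distrib-+ (λ v → 2 * ⟦ D v ⟧) sent ⟨
        ∑ (λ v → 2 * ⟦ D v ⟧ + sent v)           ≤⟨ ∑-mono balance ⟩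
        ∑ (λ v → initial v + received v)         ≡⟨ ∑-distrib-+ initial received ⟩
        ∑ initial + ∑ received                   ≡⟨ cong (∑ initial +_) (∑-comm (λ v l → ⟦ transfer l v ⟧)) ⟨
        ∑ initial + ∑ sent                       ∎

    ∑-pairs-local : ∑ (λ i → pairs (local i)) ≤ pairs internal
    ∑-pairs-local = begin
      ∑ (λ i → ∑ λ u → ∑ λ v → ⟦ local i u v ⟧)  ≡⟨ ∑-comm (λ i u → count (local i u)) ⟩
      ∑ (λ u → ∑ λ i → ∑ λ v → ⟦ local i u v ⟧)  ≡⟨ sum-cong-≗ (λ u → ∑-comm (λ i v → ⟦ local i u v ⟧)) ⟩
      ∑ (λ u → ∑ λ v → ∑ λ i → ⟦ local i u v ⟧)
        ≤⟨ ∑∑-mono (λ u v → count-∧-unique (mem F u v) _ (one-ball u v)) ⟩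
      pairs internal                              ∎
      where
      open ≤-Reasoning
      one-ball : ∀ u v → Unique (λ i → ball i u ∧ ball i v)
      one-ball u v i j iuv juv = balls-disjoint (proj₁ (∧-elim iuv)) (proj₁ (∧-elim juv))

    ∑-count-D∩centre : ∑ (λ i → count λ l → D l ∧ centre i l) ≤ count D
    ∑-count-D∩centre = begin
      ∑ (λ i → ∑ λ l → ⟦ D l ∧ centre i l ⟧)  ≡⟨ ∑-comm (λ i l → ⟦ D l ∧ centre i l ⟧) ⟩
      ∑ (λ l → ∑ λ i → ⟦ D l ∧ centre i l ⟧)
        ≤⟨ ∑-mono (λ l → count-∧-unique (D l) (λ i → centre i l) one-centre) ⟩
      ∑ (λ l → ⟦ D l ∧ any (λ i → centre i l) ⟧)
        ≤⟨ ∑-mono (λ l → ⟦∧⟧≤ˡ (D l) _) ⟩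
      count D                                  ∎
      where
      open ≤-Reasoning
      one-centre : ∀ {l} → Unique (λ i → centre i l)
      one-centre i j il jl = balls-disjoint (centre⇒ball il) (centre⇒ball jl)

    module Repairs (c3 : ComponentsAtLeast3 G) where
      open Apex G c3

      -- Only the partner of a leaf matters; other vertices are repaired through any G-neighbour.
      partner : Fin n → Fin n
      partner l = if leaf l then β l else neighbour l

      partner-leaf : ∀ {l} → leaf l ≡ true → partner l ≡ β l
      partner-leaf {l} ll = cong (λ c → if c then β l else neighbour l) ll

      partner-nonleaf : ∀ {l} → leaf l ≡ false → partner l ≡ neighbour l
      partner-nonleaf {l} ¬ll = cong (λ c → if c then β l else neighbour l) ¬ll

      patch : Fin n → Rel n
      patch l = closing l (partner l)

      repairEdge : Fin t → Rel n
      repairEdge i a b = local i a b ∨ any (λ l → (D l ∧ centre i l) ∧ patch l a b)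

      repairEdge-sym : ∀ i a b → repairEdge i a b ≡ repairEdge i b a
      repairEdge-sym i a b = cong₂ _∨_
                (cong₂ _∧_ (memSym F a b) (∧-comm (ball i a) (ball i b)))
                (any-cong λ l → cong ((D l ∧ centre i l) ∧_) (closing-sym l (partner l) a b))

      repairEdge-nonEdge : ∀ i a b → repairEdge i a b ≡ true → (a ≢ b) × (adj G a b ≡ false)
      repairEdge-nonEdge i a b ab =
        [ (λ loc → nonEdge F a b (proj₁ (∧-elim {mem F a b} loc))) , from-patch ]′ (∨-elim {local i a b} ab)
        where
        from-patch : any (λ l → (D l ∧ centre i l) ∧ patch l a b) ≡ true → (a ≢ b) × (adj G a b ≡ false)
        from-patch patched = let l , pl = any-elim (λ l → (D l ∧ centre i l) ∧ patch l a b) patched in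
          closing-nonEdge l (partner l) (proj₂ (∧-elim {D l ∧ centre i l} pl))

      repair : Fin t → NonEdgeSet G
      repair i = record { mem = repairEdge i ; memSym = repairEdge-sym i ; nonEdge = repairEdge-nonEdge i }

      pairs-repair : ∀ i → pairs (mem (repair i)) ≤ pairs (local i) + 2 * count (λ l → D l ∧ centre i l)
      pairs-repair i = begin
        pairs (mem (repair i))
          ≤⟨ pairs-∨ (local i) (λ a b → any λ l → (D l ∧ centre i l) ∧ patch l a b) ⟩
        pairs (local i) + pairs (λ a b → any λ l → (D l ∧ centre i l) ∧ patch l a b)
          ≤⟨ +-monoʳ-≤ (pairs (local i)) (pairs-any (λ l a b → (D l ∧ centre i l) ∧ patch l a b)) ⟩
        pairs (local i) + ∑ (λ l → pairs λ a b → (D l ∧ centre i l) ∧ patch l a b)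
          ≤⟨ +-monoʳ-≤ (pairs (local i)) (∑-mono λ l → pairs-guarded (D l ∧ centre i l) l) ⟩
        pairs (local i) + ∑ (λ l → 2 * ⟦ D l ∧ centre i l ⟧)
          ≡⟨ cong (pairs (local i) +_) (*-distribˡ-sum 2 (λ l → ⟦ D l ∧ centre i l ⟧)) ⟨
        pairs (local i) + 2 * count (λ l → D l ∧ centre i l) ∎
        where
        open ≤-Reasoning
        pairs-guarded : ∀ c l → pairs (λ a b → c ∧ patch l a b) ≤ 2 * ⟦ c ⟧
        pairs-guarded true  l = pairs-closing l (partner l)
        pairs-guarded false l = ≤-reflexive (trans (sum-cong-≗ {n} (λ _ → ∑-zero n)) (∑-zero n))

      pairs-repairs : ∑ (λ i → pairs (mem (repair i))) ≤ pairs (mem F)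
      pairs-repairs = begin
        ∑ (λ i → pairs (mem (repair i)))
          ≤⟨ ∑-mono pairs-repair ⟩
        ∑ (λ i → pairs (local i) + 2 * count (λ l → D l ∧ centre i l))
          ≡⟨ ∑-distrib-+ (λ i → pairs (local i)) (λ i → 2 * count (λ l → D l ∧ centre i l)) ⟩
        ∑ (λ i → pairs (local i)) + ∑ (λ i → 2 * count (λ l → D l ∧ centre i l))
          ≡⟨ cong (∑ (λ i → pairs (local i)) +_) (*-distribˡ-sum 2 (λ i → count λ l → D l ∧ centre i l)) ⟨
        ∑ (λ i → pairs (local i)) + 2 * ∑ (λ i → count λ l → D l ∧ centre i l)
          ≤⟨ +-mono-≤ ∑-pairs-local (*-monoʳ-≤ 2 ∑-count-D∩centre) ⟩
        pairs internal + 2 * count D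
          ≤⟨ +-monoʳ-≤ (pairs internal) D-bound ⟩
        pairs internal + pairs external
          ≡⟨ pairs-split (mem F) sameBall ⟨
        pairs (mem F) ∎
        where open ≤-Reasoning

      module _ (i : Fin t) where
        E⁺ᵢ : Rel n
        E⁺ᵢ = adjPlus G (repair i)

        E⁺ᵢ-sym : ∀ a b → E⁺ᵢ a b ≡ E⁺ᵢ b a
        E⁺ᵢ-sym a b = cong₂ _∨_ (adj-sym G a b) (memSym (repair i) a b)

        adj⊆E⁺ᵢ : ∀ a b → adj G a b ≡ true → E⁺ᵢ a b ≡ true
        adj⊆E⁺ᵢ a b = ∨-introˡ _

        inside⊆E⁺ᵢ : ∀ {a b} → ball i a ≡ true → ball i b ≡ true → E⁺ a b ≡ true → E⁺ᵢ a b ≡ true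
        inside⊆E⁺ᵢ {a} {b} ia ib ab =
          [ adj⊆E⁺ᵢ a b , (λ F-ab → ∨-introʳ (adj G a b) (∨-introˡ _ (∧-intro F-ab (∧-intro ia ib)))) ]′
            (∨-elim {adj G a b} ab)

        patch⊆E⁺ᵢ : ∀ {l} → D l ≡ true → centre i l ≡ true → ∀ a b → patch l a b ≡ true → E⁺ᵢ a b ≡ true
        patch⊆E⁺ᵢ {l} Dl il a b pab =
          ∨-introʳ (adj G a b) (∨-introʳ (local i a b) (any-intro _ l (∧-intro (∧-intro Dl il) pab)))

        leaf-edge : ∀ {l} → centre i l ≡ true → leaf l ≡ true → E⁺ᵢ l (β l) ≡ true
        leaf-edge {l} il ll = inside⊆E⁺ᵢ (centre⇒ball il) (leaf-β-ball il ll) (proj₁ (β-triangle l))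

        partner-edge : ∀ {l} → D l ≡ true → centre i l ≡ true → E⁺ᵢ l (partner l) ≡ true
        partner-edge {l} Dl il = by-cases (leaf l ≟ᵇ true)
          where
          by-cases : Dec (leaf l ≡ true) → E⁺ᵢ l (partner l) ≡ true
          by-cases (yes ll)  = subst (λ p → E⁺ᵢ l p ≡ true) (sym (partner-leaf ll)) (leaf-edge il ll)
          by-cases (no  ¬ll) = subst (λ p → E⁺ᵢ l p ≡ true) (sym (partner-nonleaf (¬-not ¬ll)))
                                     (adj⊆E⁺ᵢ l (neighbour l) (neighbour-adj l))

        patched : ∀ {l} → D l ≡ true → centre i l ≡ true →
          InTriangle G (repair i) l × InTriangle G (repair i) (partner l)
        patched {l} Dl il =
          let lx , px = closing-triangle E⁺ᵢ l (partner l) adj⊆E⁺ᵢ (patch⊆E⁺ᵢ Dl il)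
              lp = partner-edge Dl il
          in (partner l , apex l (partner l) , lp , lx , px)
           , (l , apex l (partner l) , trans (E⁺ᵢ-sym _ _) lp , px , lx)

        good-covered : ∀ {v} → centre i v ≡ true → bad v ≡ false → InTriangle G (repair i) v
        good-covered {v} iv good =
          let i₁ , i₂ = good-triangle iv good
              v₁ , v₂ , t₁₂ = proj₂ (proj₂ (Δ v))
          in tri₁ v , tri₂ v , inside⊆E⁺ᵢ (centre⇒ball iv) i₁ v₁ , inside⊆E⁺ᵢ (centre⇒ball iv) i₂ v₂
           , inside⊆E⁺ᵢ i₁ i₂ t₁₂

        partner-covered : ∀ {v b m} → centre i v ≡ true → rep b ≡ just m → β m ≡ v →
          InTriangle G (repair i) v
        partner-covered {v} {b} {m} iv eq βm≡v =
          subst (InTriangle G (repair i)) partner≡v (proj₂ (patched (rep-D eq) im))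
          where
          lm = proj₁ (rep-leaf eq)
          partner≡v : partner m ≡ v
          partner≡v = trans (partner-leaf lm) βm≡v
          j = proj₁ (bad-centre (proj₁ (leaf-elim lm)))
          jm = proj₂ (bad-centre (proj₁ (leaf-elim lm)))
          im : centre i m ≡ true
          im = subst (λ k → centre k m ≡ true)
                 (balls-disjoint (subst (λ x → ball j x ≡ true) βm≡v (leaf-β-ball jm lm)) (centre⇒ball iv)) jm

        completes : Completes G (repair i) (X i)
        completes v v∈Xᵢ = by-cases (bad v ≟ᵇ true) (covered v ≟ᵇ true)
          where
          iv : centre i v ≡ true
          iv = []=⇒lookup v∈Xᵢ
          by-cases : Dec (bad v ≡ true) → Dec (covered v ≡ true) → InTriangle G (repair i) v
          by-cases (no good) _ = good-covered iv (¬-not good)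
          by-cases (yes bv) (no uncovered) = proj₁ (patched (∧-intro bv (not-intro (¬-not uncovered))) iv)
          by-cases (yes bv) (yes cv) = let b , m , eq , βm≡v = covered-elim cv in partner-covered iv eq βm≡v

corollary4p3 : ∀ {n t : ℕ} (G : Graph n) (X : Fin t → Subset n) (a : Fin t → ℕ) →
    ComponentsAtLeast3 G →
    (∀ i j → i ≢ j → DistAtLeast G (X i) (X j) 3) →
    (∀ i (F : NonEdgeSet G) → Completes G F (X i) → a i ≤ size F) →
    ∀ (F : NonEdgeSet G) → IsΔCompletion G F → sum (tabulate a) ≤ size F
corollary4p3 G X a c3 far lower F Δ = *-cancelˡ-≤ 2 (begin
  2 * sum (tabulate a)             ≡⟨ cong (2 *_) (sum-tabulate a) ⟩
  2 * ∑ a                          ≤⟨ *-monoʳ-≤ 2 (∑-mono λ i → lower i (repair i) (completes i)) ⟩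
  2 * ∑ (λ i → size (repair i))    ≡⟨ *-distribˡ-sum 2 (λ i → size (repair i)) ⟩
  ∑ (λ i → 2 * size (repair i))    ≡⟨ sum-cong-≗ (λ i → pairs-mem (repair i)) ⟨
  ∑ (λ i → pairs (mem (repair i))) ≤⟨ pairs-repairs ⟩
  pairs (mem F)                    ≡⟨ pairs-mem F ⟩
  2 * size F                       ∎)
  where
  open ≤-Reasoning
  open Separated.Completion.Repairs G X far F Δ c3
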